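{- For every $n\ge1$, the number of subsets $A\subseteq\mathbb{F}_2^n$ with $A+A\neq\mathbb{F}_2^n$ is at most $2^n\cdot 3^{2^{n-1}}$.
   Context: $A+A=\{a+b : a,b\in A\}$ (with $a=b$ allowed). -}

module Defs where

open import Data.Bool using (Bool; true; _xor_)
open import Data.Nat using (ℕ)
open import Data.Vec using (Vec; zipWith)
open import Data.Product using (∃₂; _×_)
open import Relation.Binary.PropositionalEquality using (_≡_)
open import Relation.Nullary using (¬_)

-- The vector space F₂ⁿ: F₂ is Bool with addition xor.
F₂^ : ℕ → Set
F₂^ n = Vec Bool n

_⊕_ : ∀ {n} → F₂^ n → F₂^ n → F₂^ n
_⊕_ = zipWith _xor_

Subset₂ : ℕ → Set
Subset₂ n = F₂^ n → Bool

_∈_ : ∀ {n} → F₂^ n → Subset₂ n → Set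
x ∈ A = A x ≡ true

_∈SumSet_ : ∀ {n} → F₂^ n → Subset₂ n → Set
x ∈SumSet A = ∃₂ λ a b → a ∈ A × b ∈ A × x ≡ a ⊕ b

SumSetFull : ∀ {n} → Subset₂ n → Set
SumSetFull {n} A = (x : F₂^ n) → x ∈SumSet A

_≢ₛ_ : ∀ {n} → Subset₂ n → Subset₂ n → Set
A ≢ₛ B = ¬ (∀ x → A x ≡ B x)

{-# OPTIONS --safe #-}
module Submission where

-- If x ∉ A + A then A is disjoint from its translate A ⊕ x, so it suffices to bound, for each
-- of the 2ⁿ vectors x, the number of sets A with A ∩ (A ⊕ x) = ∅. For x = 0 only A = ∅
-- qualifies. For x ≠ 0 the space is partitioned into the 2ⁿ⁻¹ pairs {a , a ⊕ x}, and A meets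
-- each pair in ∅ or in one of its two points, which leaves at most 3^(2ⁿ⁻¹) choices.

open import Defs
open import Data.Nat using (ℕ; _≤_; _*_; _^_; _∸_)
open import Data.List using (List; length)
open import Data.List.Relation.Unary.All using (All)
open import Data.List.Relation.Unary.AllPairs using (AllPairs)
open import Relation.Nullary using (¬_)

open import Data.Bool using (Bool; true; false)
open import Data.Bool.Properties using (xor-same; xor-inverseˡ; not-involutive; ¬-not)
  renaming (_≟_ to _≟ᵇ_)
open import Data.Nat using (suc; zero; _+_; z≤n; s≤s)
open import Data.Nat.Properties
  using (≤-reflexive; +-mono-≤; *-mono-≤; +-identityʳ; *-identityʳ; ^-distribˡ-+-*; module ≤-Reasoning)
open import Data.List using ([]; _∷_; _++_; map; concatMap; cartesianProductWith)
open import Data.List.Properties using (length-++; length-map; length-removeAt′)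
open import Data.List.Relation.Unary.Any as Any using (Any; here; there; index; _─_)
import Data.List.Relation.Unary.Any.Properties as Any
import Data.List.Relation.Unary.All as All
open import Data.List.Relation.Unary.All.Properties using (¬All⇒Any¬)
import Data.List.Membership.Setoid as SetoidMembership
open import Data.List.Membership.Propositional using () renaming (_∈_ to _∈ₗ_)
open import Data.List.Relation.Unary.Unique.Setoid using (Unique)
open import Data.Vec using ([]; _∷_)
open import Data.Product using (∃; _×_; _,_)
open import Function using (_∘_)
open import Relation.Binary.Bundles using (Setoid)
open import Relation.Binary.PropositionalEquality
  using (_≡_; _≗_; refl; sym; trans; cong; cong₂; _→-setoid_; module ≡-Reasoning)
open import Relation.Nullary using (Dec; contradiction)
open import Relation.Nullary.Decidable using (_×-dec_; map′)
open import Relation.Unary using (Decidable)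

module _ {a ℓ} (S : Setoid a ℓ) where
  open Setoid S using (_≈_) renaming (sym to ≈-sym; trans to ≈-trans)
  open SetoidMembership S using () renaming (_∈_ to _∈ₛ_)

  ∈-─⁺ : ∀ {x y ys} (y∈ys : y ∈ₛ ys) → x ∈ₛ ys → ¬ x ≈ y → x ∈ₛ (ys ─ y∈ys)
  ∈-─⁺ (here y≈z)   (here x≈z)   x≉y = contradiction (≈-trans x≈z (≈-sym y≈z)) x≉y
  ∈-─⁺ (here _)     (there x∈ys) _   = x∈ys
  ∈-─⁺ (there _)    (here x≈z)   _   = here x≈z
  ∈-─⁺ (there y∈ys) (there x∈ys) x≉y = there (∈-─⁺ y∈ys x∈ys x≉y)

  Unique⇒length≤ : ∀ {xs ys} → Unique S xs → All (_∈ₛ ys) xs → length xs ≤ length ys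
  Unique⇒length≤ AllPairs.[] All.[] = z≤n
  Unique⇒length≤ {x ∷ xs} {ys} (x≉xs AllPairs.∷ xs!) (x∈ys All.∷ xs⊆ys) = begin
    suc (length xs)          ≤⟨ s≤s (Unique⇒length≤ xs! xs⊆ys─x) ⟩
    suc (length (ys ─ x∈ys)) ≡⟨ length-removeAt′ ys (index x∈ys) ⟨
    length ys                ∎
    where
    open ≤-Reasoning
    xs⊆ys─x : All (_∈ₛ (ys ─ x∈ys)) xs
    xs⊆ys─x = All.zipWith (λ (y∈ys , x≉y) → ∈-─⁺ x∈ys y∈ys (x≉y ∘ ≈-sym)) (xs⊆ys , x≉xs)

length-cartesianProductWith : ∀ {A B C : Set} (f : A → B → C) (xs : List A) (ys : List B) →
  length (cartesianProductWith f xs ys) ≡ length xs * length ys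
length-cartesianProductWith f []       ys = refl
length-cartesianProductWith f (x ∷ xs) ys = begin
  length (map (f x) ys ++ cartesianProductWith f xs ys)
    ≡⟨ length-++ (map (f x) ys) ⟩
  length (map (f x) ys) + length (cartesianProductWith f xs ys)
    ≡⟨ cong₂ _+_ (length-map (f x) ys) (length-cartesianProductWith f xs ys) ⟩
  length ys + length xs * length ys ∎
  where open ≡-Reasoning

length-concatMap-≤ : ∀ {A B : Set} {f : A → List B} {k} → (∀ x → length (f x) ≤ k) →
  ∀ xs → length (concatMap f xs) ≤ length xs * k
length-concatMap-≤         bound []       = z≤n
length-concatMap-≤ {f = f} bound (x ∷ xs) = begin
  length (f x ++ concatMap f xs)          ≡⟨ length-++ (f x) ⟩
  length (f x) + length (concatMap f xs)  ≤⟨ +-mono-≤ (bound x) (length-concatMap-≤ bound xs) ⟩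
  _                                       ∎
  where open ≤-Reasoning

^-2^-suc : ∀ m k → m ^ (2 ^ k) * m ^ (2 ^ k) ≡ m ^ (2 ^ suc k)
^-2^-suc m k = begin
  m ^ (2 ^ k) * m ^ (2 ^ k)  ≡⟨ ^-distribˡ-+-* m (2 ^ k) (2 ^ k) ⟨
  m ^ (2 ^ k + 2 ^ k)        ≡⟨ cong (λ j → m ^ (2 ^ k + j)) (+-identityʳ (2 ^ k)) ⟨
  m ^ (2 ^ suc k)            ∎
  where open ≡-Reasoning

⊕-cancelʳ : ∀ {n} (a x : F₂^ n) → (a ⊕ x) ⊕ x ≡ a
⊕-cancelʳ []          []      = refl
⊕-cancelʳ (false ∷ a) (c ∷ x) = cong₂ _∷_ (xor-same c) (⊕-cancelʳ a x)
⊕-cancelʳ (true ∷ a)  (c ∷ x) = cong₂ _∷_ (xor-inverseˡ c) (⊕-cancelʳ a x)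

⊕-cancelˡ : ∀ {n} (a x : F₂^ n) → a ⊕ (a ⊕ x) ≡ x
⊕-cancelˡ []          []      = refl
⊕-cancelˡ (false ∷ a) (c ∷ x) = cong (c ∷_) (⊕-cancelˡ a x)
⊕-cancelˡ (true ∷ a)  (c ∷ x) = cong₂ _∷_ (not-involutive c) (⊕-cancelˡ a x)

allVectors : ∀ n → List (F₂^ n)
allVectors zero    = [] ∷ []
allVectors (suc n) = cartesianProductWith _∷_ (false ∷ true ∷ []) (allVectors n)

length-allVectors : ∀ n → length (allVectors n) ≡ 2 ^ n
length-allVectors zero    = refl
length-allVectors (suc n) =
  trans (length-cartesianProductWith _∷_ (false ∷ true ∷ []) (allVectors n))
        (cong (2 *_) (length-allVectors n))

∈-allVectors : ∀ {n} (x : F₂^ n) → x ∈ₗ allVectors n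
∈-allVectors []      = here refl
∈-allVectors (b ∷ x) = Any.cartesianProductWith⁺ _∷_ (cong₂ _∷_) (∈-Bools b) (∈-allVectors x)
  where
  ∈-Bools : ∀ b → b ∈ₗ false ∷ true ∷ []
  ∈-Bools false = here refl
  ∈-Bools true  = there (here refl)

module _ {n} {P : F₂^ n → Set} (P? : Decidable P) where

  ∃? : Dec (∃ P)
  ∃? = map′ Any.satisfied (λ (x , px) → Any.map (λ { refl → px }) (∈-allVectors x))
            (Any.any? P? (allVectors n))

  ¬∀⇒∃¬ : ¬ (∀ x → P x) → ∃ λ x → ¬ P x
  ¬∀⇒∃¬ ¬∀P = Any.satisfied (¬All⇒Any¬ P? (allVectors n) (¬∀P ∘ All⇒∀))
    where
    All⇒∀ : All P (allVectors n) → ∀ x → P x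
    All⇒∀ ps x = All.lookup ps (∈-allVectors x)

module _ {X : Set} where

  fromHalves : ∀ {n} → (F₂^ n → X) → (F₂^ n → X) → F₂^ (suc n) → X
  fromHalves f g (false ∷ a) = f a
  fromHalves f g (true ∷ a)  = g a

  ≗-fromHalves : ∀ {n} {h : F₂^ (suc n) → X} {f g} →
    h ∘ (false ∷_) ≗ f → h ∘ (true ∷_) ≗ g → h ≗ fromHalves f g
  ≗-fromHalves h₀≗f h₁≗g (false ∷ a) = h₀≗f a
  ≗-fromHalves h₀≗f h₁≗g (true ∷ a)  = h₁≗g a

  functions : List X → ∀ n → List (F₂^ n → X)
  functions xs zero    = map (λ x _ → x) xs
  functions xs (suc n) = cartesianProductWith fromHalves (functions xs n) (functions xs n)

  length-functions : ∀ xs n → length (functions xs n) ≡ length xs ^ (2 ^ n)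
  length-functions xs zero    = trans (length-map _ xs) (sym (*-identityʳ (length xs)))
  length-functions xs (suc n) = begin
    length (cartesianProductWith fromHalves (functions xs n) (functions xs n))
      ≡⟨ length-cartesianProductWith fromHalves (functions xs n) (functions xs n) ⟩
    length (functions xs n) * length (functions xs n)
      ≡⟨ cong₂ _*_ (length-functions xs n) (length-functions xs n) ⟩
    length xs ^ (2 ^ n) * length xs ^ (2 ^ n)
      ≡⟨ ^-2^-suc (length xs) n ⟩
    length xs ^ (2 ^ suc n) ∎
    where open ≡-Reasoning

  ∈-functions : ∀ {xs n} (h : F₂^ n → X) → (∀ a → h a ∈ₗ xs) → Any (h ≗_) (functions xs n)
  ∈-functions {n = zero}  h h∈xs = Any.map⁺ (Any.map (λ { refl [] → refl }) (h∈xs []))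
  ∈-functions {n = suc n} h h∈xs = Any.cartesianProductWith⁺ fromHalves ≗-fromHalves
    (∈-functions (h ∘ (false ∷_)) (h∈xs ∘ (false ∷_)))
    (∈-functions (h ∘ (true ∷_)) (h∈xs ∘ (true ∷_)))

MeetsTranslate : ∀ {n} → F₂^ n → Subset₂ n → Set
MeetsTranslate x A = ∃ λ a → a ∈ A × (a ⊕ x) ∈ A

meetsTranslate? : ∀ {n} (A : Subset₂ n) → Decidable (λ x → MeetsTranslate x A)
meetsTranslate? A x = ∃? (λ a → A a ≟ᵇ true ×-dec A (a ⊕ x) ≟ᵇ true)

-- For x = 1 ∷ x′ the space splits into the pairs {0 ∷ a , 1 ∷ (a ⊕ x′)}, and a set not
-- meeting its translate by x contains at most one point of each pair.
data PairTrace : Set where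
  neither lower upper : PairTrace

pairTraces : List PairTrace
pairTraces = neither ∷ lower ∷ upper ∷ []

∈-pairTraces : ∀ t → t ∈ₗ pairTraces
∈-pairTraces neither = here refl
∈-pairTraces lower   = there (here refl)
∈-pairTraces upper   = there (there (here refl))

pairTrace : Bool → Bool → PairTrace
pairTrace true  _     = lower
pairTrace false true  = upper
pairTrace false false = neither

inLower inUpper : PairTrace → Bool
inLower lower = true
inLower _     = false
inUpper upper = true
inUpper _     = false

inLower-pairTrace : ∀ p q → inLower (pairTrace p q) ≡ p
inLower-pairTrace true  _     = refl
inLower-pairTrace false true  = refl
inLower-pairTrace false false = refl

inUpper-pairTrace : ∀ p q → ¬ (p ≡ true × q ≡ true) → inUpper (pairTrace p q) ≡ q
inUpper-pairTrace true  true  ¬both = contradiction (refl , refl) ¬both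
inUpper-pairTrace true  false _     = refl
inUpper-pairTrace false true  _     = refl
inUpper-pairTrace false false _     = refl

fromPairTraces : ∀ {n} → F₂^ n → (F₂^ n → PairTrace) → Subset₂ (suc n)
fromPairTraces x t = fromHalves (inLower ∘ t) (inUpper ∘ t ∘ (_⊕ x))

fromPairTraces-cong : ∀ {n} (x : F₂^ n) {t t′} → t ≗ t′ → fromPairTraces x t ≗ fromPairTraces x t′
fromPairTraces-cong x t≗t′ (false ∷ a) = cong inLower (t≗t′ a)
fromPairTraces-cong x t≗t′ (true ∷ a)  = cong inUpper (t≗t′ (a ⊕ x))

translateFreeSets : ∀ {n} → F₂^ n → List (Subset₂ n)
translateFreeSets []                 = (λ _ → false) ∷ []
translateFreeSets (false ∷ x)        =
  cartesianProductWith fromHalves (translateFreeSets x) (translateFreeSets x)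
translateFreeSets {suc n} (true ∷ x) = map (fromPairTraces x) (functions pairTraces n)

length-translateFreeSets : ∀ {n} (x : F₂^ n) → length (translateFreeSets x) ≤ 3 ^ (2 ^ (n ∸ 1))
-- 3 ^ (2 ^ (n ∸ 1)) squares to 3 ^ (2 ^ n) only for n ≥ 1, so dimension 1 is counted directly.
length-translateFreeSets []           = s≤s z≤n
length-translateFreeSets (false ∷ []) = s≤s z≤n
length-translateFreeSets {suc (suc m)} (false ∷ x@(_ ∷ _)) = begin
  length (cartesianProductWith fromHalves (translateFreeSets x) (translateFreeSets x))
    ≡⟨ length-cartesianProductWith fromHalves (translateFreeSets x) (translateFreeSets x) ⟩
  length (translateFreeSets x) * length (translateFreeSets x)
    ≤⟨ *-mono-≤ (length-translateFreeSets x) (length-translateFreeSets x) ⟩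
  3 ^ (2 ^ m) * 3 ^ (2 ^ m)
    ≡⟨ ^-2^-suc 3 m ⟩
  3 ^ (2 ^ suc m) ∎
  where open ≤-Reasoning
length-translateFreeSets {suc n} (true ∷ x) = ≤-reflexive (begin
  length (map (fromPairTraces x) (functions pairTraces n))  ≡⟨ length-map _ (functions pairTraces n) ⟩
  length (functions pairTraces n)                           ≡⟨ length-functions pairTraces n ⟩
  3 ^ (2 ^ n)                                               ∎)
  where open ≡-Reasoning

∈-translateFreeSets : ∀ {n} (x : F₂^ n) (A : Subset₂ n) → ¬ MeetsTranslate x A →
  Any (A ≗_) (translateFreeSets x)
∈-translateFreeSets [] A ¬meets = here λ { [] → ¬-not (λ []∈A → ¬meets ([] , []∈A , []∈A)) }
∈-translateFreeSets (false ∷ x) A ¬meets = Any.cartesianProductWith⁺ fromHalves ≗-fromHalves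
  (∈-translateFreeSets x (A ∘ (false ∷_)) (λ (a , p , q) → ¬meets (false ∷ a , p , q)))
  (∈-translateFreeSets x (A ∘ (true ∷_))  (λ (a , p , q) → ¬meets (true ∷ a , p , q)))
∈-translateFreeSets {suc n} (true ∷ x) A ¬meets = Any.map⁺
  (Any.map (λ t≗t′ a → trans (A≗fromPairTraces a) (fromPairTraces-cong x t≗t′ a))
           (∈-functions t (∈-pairTraces ∘ t)))
  where
  t : F₂^ n → PairTrace
  t a = pairTrace (A (false ∷ a)) (A (true ∷ (a ⊕ x)))

  A≗fromPairTraces : A ≗ fromPairTraces x t
  A≗fromPairTraces (false ∷ a) = sym (inLower-pairTrace _ _)
  A≗fromPairTraces (true ∷ a)  = sym (begin
    inUpper (t (a ⊕ x))
      ≡⟨ inUpper-pairTrace _ _ (λ (p , q) → ¬meets (false ∷ (a ⊕ x) , p , q)) ⟩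
    A (true ∷ ((a ⊕ x) ⊕ x))
      ≡⟨ cong (λ b → A (true ∷ b)) (⊕-cancelʳ a x) ⟩
    A (true ∷ a) ∎)
    where open ≡-Reasoning

∀MeetsTranslate⇒SumSetFull : ∀ {n} {A : Subset₂ n} → (∀ x → MeetsTranslate x A) → SumSetFull A
∀MeetsTranslate⇒SumSetFull meets x =
  let a , a∈A , a⊕x∈A = meets x in a , a ⊕ x , a∈A , a⊕x∈A , sym (⊕-cancelˡ a x)

¬SumSetFull⇒∈translateFreeSets : ∀ {n} (A : Subset₂ n) → ¬ SumSetFull A →
  Any (A ≗_) (concatMap translateFreeSets (allVectors n))
¬SumSetFull⇒∈translateFreeSets A ¬full =
  let x , ¬meets = ¬∀⇒∃¬ (meetsTranslate? A) (¬full ∘ ∀MeetsTranslate⇒SumSetFull)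
  in Any.concat⁺ (Any.map⁺
       (Any.map (λ { refl → ∈-translateFreeSets x A ¬meets }) (∈-allVectors x)))

lemma4p3 : (n : ℕ) → 1 ≤ n → (L : List (Subset₂ n))
    → AllPairs _≢ₛ_ L
    → All (λ A → ¬ SumSetFull A) L
    → length L ≤ 2 ^ n * 3 ^ (2 ^ (n ∸ 1))
lemma4p3 n _ L distinct deficient = begin
  length L
    ≤⟨ Unique⇒length≤ (F₂^ n →-setoid Bool) distinct
         (All.map (¬SumSetFull⇒∈translateFreeSets _) deficient) ⟩
  length (concatMap translateFreeSets (allVectors n))
    ≤⟨ length-concatMap-≤ length-translateFreeSets (allVectors n) ⟩
  length (allVectors n) * 3 ^ (2 ^ (n ∸ 1))
    ≡⟨ cong (_* 3 ^ (2 ^ (n ∸ 1))) (length-allVectors n) ⟩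
  2 ^ n * 3 ^ (2 ^ (n ∸ 1)) ∎
  where open ≤-Reasoning
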